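{- If $\rho$ is a positive integer divisible by $9$, then $M(\rho)=4$.
   Context: For a positive integer $\rho$, let $S_\rho=\{n\in\mathbb{Z} : n\ge 0,\ n\neq\rho\}$. For a positive integer $n$, let $k_\rho(n)$ be the least positive integer $m$ such that $n=x_1^2+\cdots+x_m^2$ for some $x_1,\dots,x_m\in S_\rho$, and $k_\rho(n)=\infty$ if no such $m$ exists. Let $I(\rho)=\{n\ge1 : k_\rho(n)=\infty\}$ and $M(\rho)=\max\{k_\rho(n) : n\ge 1,\ n\notin I(\rho)\}$. -}

module Defs where

open import Data.Nat using (ℕ; _+_; _*_; _≤_; _<_)
open import Data.Vec using (Vec; []; _∷_)
open import Data.Vec.Relation.Unary.All using (All)
open import Data.Product using (Σ; _×_; ∃)
open import Relation.Binary.PropositionalEquality using (_≡_; _≢_)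
open import Relation.Nullary using (¬_)

sumSq : ∀ {m} → Vec ℕ m → ℕ
sumSq [] = 0
sumSq (x ∷ xs) = x * x + sumSq xs

-- S_ρ = {n ∈ ℤ : n ≥ 0, n ≠ ρ}; elements represented as naturals x with x ≢ ρ.
-- Rep ρ m n : n = x₁² + ⋯ + x_m² for some x₁,…,x_m ∈ S_ρ
Rep : ℕ → ℕ → ℕ → Set
Rep ρ m n = Σ (Vec ℕ m) (λ xs → All (λ x → x ≢ ρ) xs × sumSq xs ≡ n)

KIs : ℕ → ℕ → ℕ → Set
KIs ρ n k = 1 ≤ k × Rep ρ k n × (∀ m → 1 ≤ m → m < k → ¬ Rep ρ m n)

-- n ∈ I(ρ) : k_ρ(n) = ∞, i.e. no positive m gives a representation
InI : ℕ → ℕ → Set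
InI ρ n = ∀ m → 1 ≤ m → ¬ Rep ρ m n

MIs : ℕ → ℕ → Set
MIs ρ M =
  (∃ λ n → 1 ≤ n × ¬ InI ρ n × KIs ρ n M)
  × (∀ n k → 1 ≤ n → ¬ InI ρ n → KIs ρ n k → k ≤ M)

{-# OPTIONS --safe #-}
-- Every n is a sum of four squares (Lagrange, via Euler's four-square identity and descent).  If an entry
-- is ±ρ, pick two other entries x, y with 3 ∣ x ± y and reflect (ρ, x, ±y) in the plane orthogonal to
-- (1, 1, 1): since 3 ∣ ρ this gives three integers with the same sum of squares.  One of the reflections of
-- (ρ, x, y), (ρ, -x, -y), (ρ, x, -y), (ρ, -x, y) avoids ±ρ: if the first two fail then ρ ∣ 3y, so 3 ∣ y as
-- 9 ∣ ρ; if all four fail then moreover ρ ∣ x and ρ ∣ y, so x + y, x - 2y and y - 2x are congruent modulo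
-- 3ρ, yet each reflection failing means one of them is ≡ -ρ and one is ≡ ρ.  A second such step removes a
-- remaining entry ±ρ, so M(ρ) ≤ 4; and 7 = 2² + 1² + 1² + 1² is not a sum of three squares.
module Submission where

open import Defs
open import Data.Nat using (ℕ; _≤_)
open import Data.Nat.Divisibility using (_∣_)
open import Data.Nat as ℕ using (zero; suc; _<_; _%_; _/_; NonZero)
import Data.Nat.Properties as ℕ
import Data.Nat.Divisibility as ℕ
open import Data.Nat.DivMod using (m≡m%n+[m/n]*n; m%n<n)
open import Data.Nat.Induction using (<-rec)
open import Data.Nat.Primality
  using (Prime; prime; prime?; composite; ¬prime⇒composite; prime⇒irreducible; prime⇒nonZero; euclidsLemma; ¬prime[1])
import Data.Nat.Tactic.RingSolver as ℕ-Solver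
open import Data.Integer as ℤ using (ℤ; +_; -_; -[1+_]; _+_; _*_; _-_; ∣_∣; 0ℤ; 1ℤ)
import Data.Integer.Properties as ℤ
open import Data.Integer.DivMod using (_%ℕ_; _/ℕ_; a≡a%ℕn+[a/ℕn]*n; n%ℕd<d)
open import Data.Integer.Divisibility.Signed
  using (divides; ∣⇒∣ᵤ; ∣-refl; ∣-trans; ∣m∣n⇒∣m+n; ∣m∣n⇒∣m-n; ∣m⇒∣-m; ∣m+n∣n⇒∣m; *-monoʳ-∣; *-cancelˡ-∣)
  renaming (_∣_ to _∣ℤ_)
open import Data.Integer.Tactic.RingSolver using (solve-∀)
open import Data.Fin as Fin using (Fin; toℕ; fromℕ<; opposite)
import Data.Fin.Properties as Fin
open import Data.Vec using ([]; _∷_)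
open import Data.Vec.Relation.Unary.All using ([]; _∷_)
open import Data.Product using (∃; ∃₂; _×_; _,_; proj₁; proj₂)
open import Data.Sum using (_⊎_; inj₁; inj₂)
open import Data.Unit using (⊤; tt)
open import Data.Empty using (⊥; ⊥-elim)
open import Function using (_∘_; const)
open import Relation.Nullary using (¬_; Dec; yes; no; contradiction)
open import Relation.Nullary.Decidable using (from-yes; from-no; ¬?)
open import Relation.Binary.PropositionalEquality

-- Lagrange's four-square theorem

record ℤ⁴ : Set where
  constructor ⟨_,_,_,_⟩
  field x₁ x₂ x₃ x₄ : ℤ

‖_‖² : ℤ⁴ → ℤ
‖ ⟨ a , b , c , d ⟩ ‖² = a * a + b * b + c * c + d * d

FourSquares : ℤ → Set
FourSquares n = ∃ λ u → ‖ u ‖² ≡ n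

infixr 7 _⊛_
infixl 7 _⊙_
infixl 6 _−ᵥ_

_⊛_ : ℤ → ℤ⁴ → ℤ⁴
k ⊛ ⟨ a , b , c , d ⟩ = ⟨ k * a , k * b , k * c , k * d ⟩

_−ᵥ_ : ℤ⁴ → ℤ⁴ → ℤ⁴
⟨ a , b , c , d ⟩ −ᵥ ⟨ e , f , g , h ⟩ = ⟨ a - e , b - f , c - g , d - h ⟩

-- The product u · v̄ of the quaternions with coordinates u and v.
_⊙_ : ℤ⁴ → ℤ⁴ → ℤ⁴
⟨ a , b , c , d ⟩ ⊙ ⟨ e , f , g , h ⟩ =
  ⟨ a * e + b * f + c * g + d * h , a * f - b * e + c * h - d * g
  , a * g - b * h - c * e + d * f , a * h + b * g - c * f - d * e ⟩

‖⊙‖² : ∀ u v → ‖ u ⊙ v ‖² ≡ ‖ u ‖² * ‖ v ‖²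
‖⊙‖² ⟨ a , b , c , d ⟩ ⟨ e , f , g , h ⟩ = euler a b c d e f g h
  where
  euler : ∀ a b c d e f g h →
    (a * e + b * f + c * g + d * h) * (a * e + b * f + c * g + d * h)
    + (a * f - b * e + c * h - d * g) * (a * f - b * e + c * h - d * g)
    + (a * g - b * h - c * e + d * f) * (a * g - b * h - c * e + d * f)
    + (a * h + b * g - c * f - d * e) * (a * h + b * g - c * f - d * e)
    ≡ (a * a + b * b + c * c + d * d) * (e * e + f * f + g * g + h * h)
  euler = solve-∀

‖⊛‖² : ∀ k u → ‖ k ⊛ u ‖² ≡ k * k * ‖ u ‖²
‖⊛‖² k ⟨ a , b , c , d ⟩ = lemma k a b c d
  where
  lemma : ∀ k a b c d →
    k * a * (k * a) + k * b * (k * b) + k * c * (k * c) + k * d * (k * d)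
    ≡ k * k * (a * a + b * b + c * c + d * d)
  lemma = solve-∀

fourSquares-* : ∀ {m n} → FourSquares m → FourSquares n → FourSquares (m * n)
fourSquares-* (u , refl) (v , refl) = u ⊙ v , ‖⊙‖² u v

⟨⟩-cong : ∀ {a b c d a′ b′ c′ d′} → a ≡ a′ → b ≡ b′ → c ≡ c′ → d ≡ d′ →
          ⟨ a , b , c , d ⟩ ≡ ⟨ a′ , b′ , c′ , d′ ⟩
⟨⟩-cong refl refl refl refl = refl

‖−ᵥ⊛‖² : ∀ k u q → ‖ u −ᵥ k ⊛ q ‖² ≡ ‖ u ‖² - k * (+ 2 * ℤ⁴.x₁ (u ⊙ q) - k * ‖ q ‖²)
‖−ᵥ⊛‖² k ⟨ a , b , c , d ⟩ ⟨ e , f , g , h ⟩ = lemma k a b c d e f g h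
  where
  lemma : ∀ k a b c d e f g h →
    (a - k * e) * (a - k * e) + (b - k * f) * (b - k * f) + (c - k * g) * (c - k * g) + (d - k * h) * (d - k * h)
    ≡ a * a + b * b + c * c + d * d
      - k * (+ 2 * (a * e + b * f + c * g + d * h) - k * (e * e + f * f + g * g + h * h))
  lemma = solve-∀

-- Since u ⊙ u = ⟨ ‖ u ‖² , 0 , 0 , 0 ⟩, bilinearity makes u ⊙ (u − k q) divisible by k when k ∣ ‖ u ‖².
⊙-−ᵥ⊛ : ∀ k p u q → ‖ u ‖² ≡ k * p → u ⊙ (u −ᵥ k ⊛ q) ≡ k ⊛ (⟨ p , 0ℤ , 0ℤ , 0ℤ ⟩ −ᵥ u ⊙ q)
⊙-−ᵥ⊛ k p ⟨ a , b , c , d ⟩ ⟨ e , f , g , h ⟩ ‖u‖²≡kp =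
  ⟨⟩-cong (trans (first k a b c d e f g h) (trans (cong (_- k * ⟪u,q⟫) ‖u‖²≡kp) (factor k p ⟪u,q⟫)))
          (second k a b c d e f g h) (third k a b c d e f g h) (fourth k a b c d e f g h)
  where
  ⟪u,q⟫ = a * e + b * f + c * g + d * h
  first : ∀ k a b c d e f g h →
    a * (a - k * e) + b * (b - k * f) + c * (c - k * g) + d * (d - k * h)
    ≡ a * a + b * b + c * c + d * d - k * (a * e + b * f + c * g + d * h)
  first = solve-∀
  factor : ∀ k p x → k * p - k * x ≡ k * (p - x)
  factor = solve-∀
  second : ∀ k a b c d e f g h →
    a * (b - k * f) - b * (a - k * e) + c * (d - k * h) - d * (c - k * g)
    ≡ k * (0ℤ - (a * f - b * e + c * h - d * g))
  second = solve-∀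
  third : ∀ k a b c d e f g h →
    a * (c - k * g) - b * (d - k * h) - c * (a - k * e) + d * (b - k * f)
    ≡ k * (0ℤ - (a * g - b * h - c * e + d * f))
  third = solve-∀
  fourth : ∀ k a b c d e f g h →
    a * (d - k * h) + b * (c - k * g) - c * (b - k * f) - d * (a - k * e)
    ≡ k * (0ℤ - (a * h + b * g - c * f - d * e))
  fourth = solve-∀

-- The residue of x modulo m in (-m/2, m/2].
record CentredResidue (m : ℕ) (x : ℤ) : Set where
  constructor residue
  field
    quotient : ℤ
    size : ℕ
    ±size : x - + m * quotient ≡ + size ⊎ x - + m * quotient ≡ - + size
    2size≤m : 2 ℕ.* size ≤ m
    half⇒+size : 2 ℕ.* size ≡ m → x - + m * quotient ≡ + size

centredResidue : ∀ m .{{_ : ℕ.NonZero m}} x → CentredResidue m x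
centredResidue m x = fromDivMod (x %ℕ m) (x /ℕ m) (a≡a%ℕn+[a/ℕn]*n x m) (n%ℕd<d x m)
  where
  fromDivMod : ∀ r q → x ≡ + r + q * + m → r < m → CentredResidue m x
  fromDivMod r q refl r<m with 2 ℕ.* r ℕ.≤? m
  ... | yes 2r≤m = residue q r (inj₁ x-mq≡r) 2r≤m (λ _ → x-mq≡r)
    where
    x-mq≡r : + r + q * + m - + m * q ≡ + r
    x-mq≡r = lemma (+ r) q (+ m)
      where
      lemma : ∀ r q m → r + q * m - m * q ≡ r
      lemma = solve-∀
  ... | no 2r≰m = residue (q + 1ℤ) (m ℕ.∸ r) (inj₂ x-m[q+1]≡-s) (ℕ.<⇒≤ 2s<m)
                    (λ 2[m-r]≡m → contradiction 2[m-r]≡m (ℕ.<⇒≢ 2s<m))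
    where
    s = m ℕ.∸ r
    r+s≡m : r ℕ.+ s ≡ m
    r+s≡m = ℕ.m+[n∸m]≡n (ℕ.<⇒≤ r<m)
    2s<m : 2 ℕ.* s < m
    2s<m = begin-strict
      2 ℕ.* s    ≡⟨ cong (s ℕ.+_) (ℕ.+-identityʳ s) ⟩
      s ℕ.+ s    <⟨ ℕ.+-monoˡ-< s s<r ⟩
      r ℕ.+ s    ≡⟨ r+s≡m ⟩
      m          ∎
      where
      open ℕ.≤-Reasoning
      s<r : s < r
      s<r = ℕ.+-cancelˡ-< r s r (begin-strict
        r ℕ.+ s    ≡⟨ r+s≡m ⟩
        m          <⟨ ℕ.≰⇒> 2r≰m ⟩
        2 ℕ.* r    ≡⟨ cong (r ℕ.+_) (ℕ.+-identityʳ r) ⟩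
        r ℕ.+ r    ∎)
    x-m[q+1]≡-s : + r + q * + m - + m * (q + 1ℤ) ≡ - + s
    x-m[q+1]≡-s = subst (λ M → + r + q * M - M * (q + 1ℤ) ≡ - + s)
                         (trans (sym (ℤ.pos-+ r s)) (cong +_ r+s≡m)) (lemma (+ r) (+ s) q)
      where
      lemma : ∀ r s q → r + q * (r + s) - (r + s) * (q + 1ℤ) ≡ - s
      lemma = solve-∀

+-cong₄ : ∀ {a b c d a′ b′ c′ d′ : ℤ} → a ≡ a′ → b ≡ b′ → c ≡ c′ → d ≡ d′ →
          a + b + c + d ≡ a′ + b′ + c′ + d′
+-cong₄ refl refl refl refl = refl

+-sum₄ : ∀ a b c d → + (a ℕ.+ b ℕ.+ c ℕ.+ d) ≡ + a + + b + + c + + d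
+-sum₄ a b c d rewrite ℤ.pos-+ (a ℕ.+ b ℕ.+ c) d | ℤ.pos-+ (a ℕ.+ b) c | ℤ.pos-+ a b = refl

±n² : ∀ {y n} → y ≡ + n ⊎ y ≡ - + n → y * y ≡ + (n ℕ.* n)
±n² {n = n} (inj₁ refl) = sym (ℤ.pos-* n n)
±n² {n = n} (inj₂ refl) = trans (lemma (+ n)) (sym (ℤ.pos-* n n))
  where
  lemma : ∀ y → (- y) * (- y) ≡ y * y
  lemma = solve-∀

sum-of-squares≡0 : ∀ a b c d → a ℕ.* a ℕ.+ b ℕ.* b ℕ.+ c ℕ.* c ℕ.+ d ℕ.* d ≡ 0 →
          a ≡ 0 × b ≡ 0 × c ≡ 0 × d ≡ 0
sum-of-squares≡0 zero zero zero zero _ = refl , refl , refl , refl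

sum-of-squares-< : ∀ {N a b c d} → a ≤ N → b ≤ N → c ≤ N → d ≤ N → a < N ⊎ b < N ⊎ c < N ⊎ d < N →
          a ℕ.* a ℕ.+ b ℕ.* b ℕ.+ c ℕ.* c ℕ.+ d ℕ.* d < 4 ℕ.* (N ℕ.* N)
sum-of-squares-< {N} a≤ b≤ c≤ d≤ some< =
  ℕ.<-≤-trans (sum< (sq≤ a≤) (sq≤ b≤) (sq≤ c≤) (sq≤ d≤) (sq< some<)) (ℕ.≤-reflexive (sym (4M (N ℕ.* N))))
  where
  sq≤ : ∀ {x} → x ≤ N → x ℕ.* x ≤ N ℕ.* N
  sq≤ x≤N = ℕ.*-mono-≤ x≤N x≤N
  sq< : ∀ {a b c d} → a < N ⊎ b < N ⊎ c < N ⊎ d < N →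
        a ℕ.* a < N ℕ.* N ⊎ b ℕ.* b < N ℕ.* N ⊎ c ℕ.* c < N ℕ.* N ⊎ d ℕ.* d < N ℕ.* N
  sq< (inj₁ a<N) = inj₁ (ℕ.*-mono-< a<N a<N)
  sq< (inj₂ (inj₁ b<N)) = inj₂ (inj₁ (ℕ.*-mono-< b<N b<N))
  sq< (inj₂ (inj₂ (inj₁ c<N))) = inj₂ (inj₂ (inj₁ (ℕ.*-mono-< c<N c<N)))
  sq< (inj₂ (inj₂ (inj₂ d<N))) = inj₂ (inj₂ (inj₂ (ℕ.*-mono-< d<N d<N)))
  4M : ∀ M → 4 ℕ.* M ≡ M ℕ.+ M ℕ.+ M ℕ.+ M
  4M = ℕ-Solver.solve-∀
  sum< : ∀ {M a b c d} → a ≤ M → b ≤ M → c ≤ M → d ≤ M → a < M ⊎ b < M ⊎ c < M ⊎ d < M →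
         a ℕ.+ b ℕ.+ c ℕ.+ d < M ℕ.+ M ℕ.+ M ℕ.+ M
  sum< _ b≤ c≤ d≤ (inj₁ a<) = ℕ.+-mono-<-≤ (ℕ.+-mono-<-≤ (ℕ.+-mono-<-≤ a< b≤) c≤) d≤
  sum< a≤ _ c≤ d≤ (inj₂ (inj₁ b<)) = ℕ.+-mono-<-≤ (ℕ.+-mono-<-≤ (ℕ.+-mono-≤-< a≤ b<) c≤) d≤
  sum< a≤ b≤ _ d≤ (inj₂ (inj₂ (inj₁ c<))) = ℕ.+-mono-<-≤ (ℕ.+-mono-≤-< (ℕ.+-mono-≤ a≤ b≤) c<) d≤
  sum< a≤ b≤ c≤ _ (inj₂ (inj₂ (inj₂ d<))) = ℕ.+-mono-≤-< (ℕ.+-mono-≤ (ℕ.+-mono-≤ a≤ b≤) c≤) d<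

some-<-or-all-≡ : ∀ {N a b c d} → a ≤ N → b ≤ N → c ≤ N → d ≤ N →
                  (a < N ⊎ b < N ⊎ c < N ⊎ d < N) ⊎ (a ≡ N × b ≡ N × c ≡ N × d ≡ N)
some-<-or-all-≡ a≤ b≤ c≤ d≤
  with ℕ.m≤n⇒m<n∨m≡n a≤ | ℕ.m≤n⇒m<n∨m≡n b≤ | ℕ.m≤n⇒m<n∨m≡n c≤ | ℕ.m≤n⇒m<n∨m≡n d≤
... | inj₁ a< | _      | _      | _      = inj₁ (inj₁ a<)
... | inj₂ _  | inj₁ b< | _      | _      = inj₁ (inj₂ (inj₁ b<))
... | inj₂ _  | inj₂ _  | inj₁ c< | _      = inj₁ (inj₂ (inj₂ (inj₁ c<)))
... | inj₂ _  | inj₂ _  | inj₂ _  | inj₁ d< = inj₁ (inj₂ (inj₂ (inj₂ d<)))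
... | inj₂ a≡ | inj₂ b≡ | inj₂ c≡ | inj₂ d≡ = inj₂ (a≡ , b≡ , c≡ , d≡)

module _ {m : ℕ} {x : ℤ} (r : CentredResidue m x) where
  open CentredResidue r

  residue-zero : size ≡ 0 → x ≡ + m * quotient
  residue-zero refl = ℤ.i-j≡0⇒i≡j x _ (zero± ±size)
    where
    zero± : ∀ {y} → y ≡ + 0 ⊎ y ≡ - + 0 → y ≡ 0ℤ
    zero± (inj₁ y≡0) = y≡0
    zero± (inj₂ y≡0) = y≡0

  residue-half : 2 ℕ.* size ≡ m → + 2 * x ≡ + m * (1ℤ + + 2 * quotient)
  residue-half 2size≡m = begin
    + 2 * x                          ≡⟨ lemma x (+ m) quotient ⟩
    + 2 * (x - + m * quotient) + 2mq ≡⟨ cong (λ y → + 2 * y + 2mq) (half⇒+size 2size≡m) ⟩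
    + 2 * + size + 2mq               ≡⟨ cong (_+ 2mq) (trans (sym (ℤ.pos-* 2 size)) (cong +_ 2size≡m)) ⟩
    + m + 2mq                        ≡⟨ lemma′ (+ m) quotient ⟩
    + m * (1ℤ + + 2 * quotient)      ∎
    where
    open ≡-Reasoning
    2mq = + m * (+ 2 * quotient)
    lemma : ∀ x m q → + 2 * x ≡ + 2 * (x - m * q) + m * (+ 2 * q)
    lemma = solve-∀
    lemma′ : ∀ m q → m + m * (+ 2 * q) ≡ m * (1ℤ + + 2 * q)
    lemma′ = solve-∀

small-residue-or-m²∣ : ∀ m .{{_ : ℕ.NonZero m}} u →
  (∃₂ λ q S → ‖ u −ᵥ + m ⊛ q ‖² ≡ + S × 0 < S × S < m ℕ.* m) ⊎ (+ m * + m) ∣ℤ ‖ u ‖²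
small-residue-or-m²∣ m u@(⟨ a , b , c , d ⟩) = classify (S ℕ.≟ 0) (some-<-or-all-≡ na≤ nb≤ nc≤ nd≤)
  where
  ra = centredResidue m a
  rb = centredResidue m b
  rc = centredResidue m c
  rd = centredResidue m d
  open CentredResidue ra renaming (quotient to qa; size to na; ±size to ya; 2size≤m to na≤)
  open CentredResidue rb renaming (quotient to qb; size to nb; ±size to yb; 2size≤m to nb≤)
  open CentredResidue rc renaming (quotient to qc; size to nc; ±size to yc; 2size≤m to nc≤)
  open CentredResidue rd renaming (quotient to qd; size to nd; ±size to yd; 2size≤m to nd≤)
  q = ⟨ qa , qb , qc , qd ⟩
  S = na ℕ.* na ℕ.+ nb ℕ.* nb ℕ.+ nc ℕ.* nc ℕ.+ nd ℕ.* nd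

  ‖v‖² : ‖ u −ᵥ + m ⊛ q ‖² ≡ + S
  ‖v‖² = trans (+-cong₄ (±n² ya) (±n² yb) (±n² yc) (±n² yd))
               (sym (+-sum₄ (na ℕ.* na) (nb ℕ.* nb) (nc ℕ.* nc) (nd ℕ.* nd)))

  zero-case : S ≡ 0 → (+ m * + m) ∣ℤ ‖ u ‖²
  zero-case S≡0 = divides ‖ q ‖² (trans (cong ‖_‖² u≡mq) (trans (‖⊛‖² (+ m) q) (ℤ.*-comm (+ m * + m) ‖ q ‖²)))
    where
    u≡mq : u ≡ + m ⊛ q
    u≡mq with sum-of-squares≡0 na nb nc nd S≡0
    ... | a≡ , b≡ , c≡ , d≡ =
      ⟨⟩-cong (residue-zero ra a≡) (residue-zero rb b≡) (residue-zero rc c≡) (residue-zero rd d≡)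

  S<m² : (2 ℕ.* na < m ⊎ 2 ℕ.* nb < m ⊎ 2 ℕ.* nc < m ⊎ 2 ℕ.* nd < m) → S < m ℕ.* m
  S<m² some< = ℕ.*-cancelˡ-< 4 _ _
    (subst (_< 4 ℕ.* (m ℕ.* m)) (4S na nb nc nd) (sum-of-squares-< na≤ nb≤ nc≤ nd≤ some<))
    where
    4S : ∀ a b c d → (2 ℕ.* a) ℕ.* (2 ℕ.* a) ℕ.+ (2 ℕ.* b) ℕ.* (2 ℕ.* b)
                     ℕ.+ (2 ℕ.* c) ℕ.* (2 ℕ.* c) ℕ.+ (2 ℕ.* d) ℕ.* (2 ℕ.* d)
           ≡ 4 ℕ.* (a ℕ.* a ℕ.+ b ℕ.* b ℕ.+ c ℕ.* c ℕ.+ d ℕ.* d)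
    4S = ℕ-Solver.solve-∀

  half-case : 2 ℕ.* na ≡ m → 2 ℕ.* nb ≡ m → 2 ℕ.* nc ≡ m → 2 ℕ.* nd ≡ m → (+ m * + m) ∣ℤ ‖ u ‖²
  half-case a≡ b≡ c≡ d≡ = divides K (ℤ.*-cancelˡ-≡ (+ 4) _ _ 4‖u‖²)
    where
    w = ⟨ 1ℤ + + 2 * qa , 1ℤ + + 2 * qb , 1ℤ + + 2 * qc , 1ℤ + + 2 * qd ⟩
    K = 1ℤ + (qa + qa * qa) + (qb + qb * qb) + (qc + qc * qc) + (qd + qd * qd)
    ‖w‖² : ‖ w ‖² ≡ + 4 * K
    ‖w‖² = lemma qa qb qc qd
      where
      lemma : ∀ a b c d → (1ℤ + + 2 * a) * (1ℤ + + 2 * a) + (1ℤ + + 2 * b) * (1ℤ + + 2 * b)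
                          + (1ℤ + + 2 * c) * (1ℤ + + 2 * c) + (1ℤ + + 2 * d) * (1ℤ + + 2 * d)
              ≡ + 4 * (1ℤ + (a + a * a) + (b + b * b) + (c + c * c) + (d + d * d))
      lemma = solve-∀
    2u≡mw : + 2 ⊛ u ≡ + m ⊛ w
    2u≡mw = ⟨⟩-cong (residue-half ra a≡) (residue-half rb b≡) (residue-half rc c≡) (residue-half rd d≡)
    4‖u‖² : + 4 * ‖ u ‖² ≡ + 4 * (K * (+ m * + m))
    4‖u‖² = begin
      + 4 * ‖ u ‖²             ≡⟨ sym (‖⊛‖² (+ 2) u) ⟩
      ‖ + 2 ⊛ u ‖²             ≡⟨ cong ‖_‖² 2u≡mw ⟩
      ‖ + m ⊛ w ‖²             ≡⟨ ‖⊛‖² (+ m) w ⟩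
      + m * + m * ‖ w ‖²       ≡⟨ cong (+ m * + m *_) ‖w‖² ⟩
      + m * + m * (+ 4 * K)    ≡⟨ lemma (+ m * + m) K ⟩
      + 4 * (K * (+ m * + m))  ∎
      where
      open ≡-Reasoning
      lemma : ∀ M K → M * (+ 4 * K) ≡ + 4 * (K * M)
      lemma = solve-∀

  classify : Dec (S ≡ 0) → _ → (∃₂ λ q S → ‖ u −ᵥ + m ⊛ q ‖² ≡ + S × 0 < S × S < m ℕ.* m) ⊎ (+ m * + m) ∣ℤ ‖ u ‖²
  classify (yes S≡0) _ = inj₂ (zero-case S≡0)
  classify (no S≢0) (inj₁ some<) = inj₁ (q , S , ‖v‖² , ℕ.n≢0⇒n>0 S≢0 , S<m² some<)
  classify _ (inj₂ (a≡ , b≡ , c≡ , d≡)) = inj₂ (half-case a≡ b≡ c≡ d≡)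

prime⇒¬proper-∣ : ∀ {p m} → Prime p → 1 < m → m < p → ¬ (+ m ∣ℤ + p)
prime⇒¬proper-∣ (prime notComposite) (ℕ.s≤s (ℕ.s≤s ℕ.z≤n)) m<p m∣p =
  notComposite (ℕ.hasNonTrivialDivisor m<p (∣⇒∣ᵤ m∣p))

-- Euler's descent: reduce u modulo m to v with 0 < ‖ v ‖² = m r < m²; then u ⊙ v = m w with ‖ w ‖² = r p.
descent-step : ∀ {p m} → Prime p → 1 < m → m < p → FourSquares (+ m * + p) →
               ∃ λ r → 0 < r × r < m × FourSquares (+ r * + p)
descent-step {p} {m} p-prime 1<m@(ℕ.s≤s (ℕ.s≤s ℕ.z≤n)) m<p (u , ‖u‖²≡mp) with small-residue-or-m²∣ m u
... | inj₂ (divides K ‖u‖²≡Km²) = contradiction m∣p (prime⇒¬proper-∣ p-prime 1<m m<p)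
  where
  m∣p : + m ∣ℤ + p
  m∣p = divides K (ℤ.*-cancelˡ-≡ (+ m) _ _ (trans (sym ‖u‖²≡mp) (trans ‖u‖²≡Km² (lemma (+ m) K))))
    where
    lemma : ∀ m K → K * (m * m) ≡ m * (K * m)
    lemma = solve-∀
... | inj₁ (q , S , ‖v‖²≡S , 0<S , S<m²) = r , 0<r , r<m , w , ‖w‖²≡rp
  where
  v = u −ᵥ + m ⊛ q
  X = + 2 * ℤ⁴.x₁ (u ⊙ q) - + m * ‖ q ‖²
  R = + p - X
  r = ∣ R ∣
  ‖v‖²≡mR : ‖ v ‖² ≡ + m * R
  ‖v‖²≡mR = begin
    ‖ v ‖²                ≡⟨ ‖−ᵥ⊛‖² (+ m) u q ⟩
    ‖ u ‖² - + m * X      ≡⟨ cong (_- + m * X) ‖u‖²≡mp ⟩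
    + m * + p - + m * X   ≡⟨ factor (+ m) (+ p) X ⟩
    + m * R               ∎
    where
    open ≡-Reasoning
    factor : ∀ m p x → m * p - m * x ≡ m * (p - x)
    factor = solve-∀
  S≡mr : S ≡ m ℕ.* r
  S≡mr = trans (cong ∣_∣ (trans (sym ‖v‖²≡S) ‖v‖²≡mR)) (ℤ.abs-* (+ m) R)
  0<r : 0 < r
  0<r = ℕ.n≢0⇒n>0 λ r≡0 → ℕ.<⇒≢ 0<S (sym (trans S≡mr (trans (cong (m ℕ.*_) r≡0) (ℕ.*-zeroʳ m))))
  r<m : r < m
  r<m = ℕ.*-cancelˡ-< m r m (subst (_< m ℕ.* m) S≡mr S<m²)
  w = ⟨ + p , 0ℤ , 0ℤ , 0ℤ ⟩ −ᵥ u ⊙ q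
  ‖w‖²≡rp : ‖ w ‖² ≡ + r * + p
  ‖w‖²≡rp = ℤ.*-cancelˡ-≡ (+ m * + m) _ _ (begin
    + m * + m * ‖ w ‖²       ≡⟨ ‖⊛‖² (+ m) w ⟨
    ‖ + m ⊛ w ‖²             ≡⟨ cong ‖_‖² (⊙-−ᵥ⊛ (+ m) (+ p) u q ‖u‖²≡mp) ⟨
    ‖ u ⊙ v ‖²               ≡⟨ ‖⊙‖² u v ⟩
    ‖ u ‖² * ‖ v ‖²          ≡⟨ cong₂ _*_ ‖u‖²≡mp (trans ‖v‖²≡S (trans (cong +_ S≡mr) (ℤ.pos-* m r))) ⟩
    + m * + p * (+ m * + r)  ≡⟨ lemma (+ m) (+ p) (+ r) ⟩
    + m * + m * (+ r * + p)  ∎)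
    where
    open ≡-Reasoning
    lemma : ∀ m p r → m * p * (m * r) ≡ m * m * (r * p)
    lemma = solve-∀

descent : ∀ {p} → Prime p → ∀ m → 0 < m → m < p → FourSquares (+ m * + p) → FourSquares (+ p)
descent {p} p-prime = <-rec (λ m → 0 < m → m < p → FourSquares (+ m * + p) → FourSquares (+ p)) step
  where
  step : ∀ m → (∀ {r} → r < m → 0 < r → r < p → FourSquares (+ r * + p) → FourSquares (+ p)) →
         0 < m → m < p → FourSquares (+ m * + p) → FourSquares (+ p)
  step (suc zero) _ _ _ (u , ‖u‖²≡p) = u , trans ‖u‖²≡p (ℤ.*-identityˡ (+ p))
  step m@(suc (suc _)) rec _ m<p mp-squares with descent-step p-prime (ℕ.s≤s (ℕ.s≤s ℕ.z≤n)) m<p mp-squares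
  ... | r , 0<r , r<m , rp-squares = rec r<m 0<r (ℕ.<-trans r<m m<p) rp-squares

module _ {p h : ℕ} (p-prime : Prime p) (p≡2h+1 : p ≡ suc (2 ℕ.* h)) where
  private instance
    p≢0 : NonZero p
    p≢0 = prime⇒nonZero p-prime

  2h<p : h ℕ.+ h < p
  2h<p = ℕ.≤-reflexive (sym (trans p≡2h+1 (cong (λ n → suc (h ℕ.+ n)) (ℕ.+-identityʳ h))))

  h<p : h < p
  h<p = ℕ.≤-<-trans (ℕ.m≤m+n h h) 2h<p

  squares-distinct-mod : ∀ {a b} → a < b → b ≤ h → (a ℕ.* a) % p ≢ (b ℕ.* b) % p
  squares-distinct-mod {a} {b} a<b b≤h a²≡b² with euclidsLemma (b ℕ.∸ a) (b ℕ.+ a) p-prime p∣[b-a][b+a]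
    where
    p∣[b-a][b+a] : p ℕ.∣ (b ℕ.∸ a) ℕ.* (b ℕ.+ a)
    p∣[b-a][b+a] = ℕ.divides ((b ℕ.* b) / p ℕ.∸ (a ℕ.* a) / p) (begin
      (b ℕ.∸ a) ℕ.* (b ℕ.+ a)                        ≡⟨ ℕ.*-distribʳ-∸ (b ℕ.+ a) b a ⟩
      b ℕ.* (b ℕ.+ a) ℕ.∸ a ℕ.* (b ℕ.+ a)            ≡⟨ cong₂ ℕ._∸_ (expandˡ b a) (expandʳ b a) ⟩
      (b ℕ.* a ℕ.+ b ℕ.* b) ℕ.∸ (b ℕ.* a ℕ.+ a ℕ.* a) ≡⟨ ℕ.[m+n]∸[m+o]≡n∸o (b ℕ.* a) (b ℕ.* b) (a ℕ.* a) ⟩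
      b ℕ.* b ℕ.∸ a ℕ.* a
        ≡⟨ cong₂ ℕ._∸_ (m≡m%n+[m/n]*n (b ℕ.* b) p) (m≡m%n+[m/n]*n (a ℕ.* a) p) ⟩
      ((b ℕ.* b) % p ℕ.+ qb ℕ.* p) ℕ.∸ ((a ℕ.* a) % p ℕ.+ qa ℕ.* p)
        ≡⟨ cong (λ r → ((b ℕ.* b) % p ℕ.+ qb ℕ.* p) ℕ.∸ (r ℕ.+ qa ℕ.* p)) a²≡b² ⟩
      ((b ℕ.* b) % p ℕ.+ qb ℕ.* p) ℕ.∸ ((b ℕ.* b) % p ℕ.+ qa ℕ.* p)
        ≡⟨ ℕ.[m+n]∸[m+o]≡n∸o ((b ℕ.* b) % p) (qb ℕ.* p) (qa ℕ.* p) ⟩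
      qb ℕ.* p ℕ.∸ qa ℕ.* p                          ≡⟨ ℕ.*-distribʳ-∸ p qb qa ⟨
      (qb ℕ.∸ qa) ℕ.* p                              ∎)
      where
      open ≡-Reasoning
      qa = (a ℕ.* a) / p
      qb = (b ℕ.* b) / p
      expandˡ : ∀ b a → b ℕ.* (b ℕ.+ a) ≡ b ℕ.* a ℕ.+ b ℕ.* b
      expandˡ = ℕ-Solver.solve-∀
      expandʳ : ∀ b a → a ℕ.* (b ℕ.+ a) ≡ b ℕ.* a ℕ.+ a ℕ.* a
      expandʳ = ℕ-Solver.solve-∀
  ... | inj₁ p∣b-a = ℕ.<-irrefl refl (ℕ.≤-<-trans (ℕ.∣⇒≤ {{ℕ.>-nonZero 0<b-a}} p∣b-a) b-a<p)
    where
    0<b-a : 0 < b ℕ.∸ a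
    0<b-a = ℕ.m<n⇒0<n∸m a<b
    b-a<p : b ℕ.∸ a < p
    b-a<p = ℕ.≤-<-trans (ℕ.m∸n≤m b a) (ℕ.≤-<-trans b≤h h<p)
  ... | inj₂ p∣b+a = ℕ.<-irrefl refl (ℕ.≤-<-trans (ℕ.∣⇒≤ {{ℕ.>-nonZero 0<b+a}} p∣b+a) b+a<p)
    where
    0<b+a : 0 < b ℕ.+ a
    0<b+a = ℕ.<-≤-trans (ℕ.≤-<-trans ℕ.z≤n a<b) (ℕ.m≤m+n b a)
    b+a<p : b ℕ.+ a < p
    b+a<p = ℕ.≤-<-trans (ℕ.+-mono-≤ b≤h (ℕ.≤-trans (ℕ.<⇒≤ a<b) b≤h)) 2h<p

  0<h : 0 < h
  0<h = ℕ.n≢0⇒n>0 λ h≡0 → ¬prime[1] (subst Prime (trans p≡2h+1 (cong (λ h → suc (2 ℕ.* h)) h≡0)) p-prime)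

  h²+h²+1<p² : h ℕ.* h ℕ.+ h ℕ.* h ℕ.+ 1 < p ℕ.* p
  h²+h²+1<p² rewrite p≡2h+1 = bound h 0<h
    where
    bound : ∀ h → 0 < h → h ℕ.* h ℕ.+ h ℕ.* h ℕ.+ 1 < suc (2 ℕ.* h) ℕ.* suc (2 ℕ.* h)
    bound (suc h) _ = ℕ.≤-trans (ℕ.m≤m+n _ (2 ℕ.* (suc h ℕ.* suc h) ℕ.+ 4 ℕ.* h ℕ.+ 3)) (ℕ.≤-reflexive (expand h))
      where
      expand : ∀ h → suc (suc h ℕ.* suc h ℕ.+ suc h ℕ.* suc h ℕ.+ 1) ℕ.+ (2 ℕ.* (suc h ℕ.* suc h) ℕ.+ 4 ℕ.* h ℕ.+ 3)
                     ≡ suc (2 ℕ.* suc h) ℕ.* suc (2 ℕ.* suc h)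
      expand = ℕ-Solver.solve-∀

  multiple-from-residues : ∀ {a b} → a ≤ h → b ≤ h → (a ℕ.* a) % p ≡ p ℕ.∸ suc ((b ℕ.* b) % p) →
                           ∃ λ m → 0 < m × m < p × FourSquares (+ m * + p)
  multiple-from-residues {a} {b} a≤h b≤h a²+b²+1≡0 =
    m , ℕ.s≤s ℕ.z≤n , m<p , ⟨ + a , + b , + 1 , + 0 ⟩ ,
    trans (+-cong₄ (sym (ℤ.pos-* a a)) (sym (ℤ.pos-* b b)) refl refl)
          (trans (sym (+-sum₄ (a ℕ.* a) (b ℕ.* b) 1 0))
                 (trans (cong +_ (trans (ℕ.+-identityʳ _) a²+b²+1≡mp)) (ℤ.pos-* m p)))
    where
    qa = (a ℕ.* a) / p
    qb = (b ℕ.* b) / p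
    m = suc (qa ℕ.+ qb)
    a²+b²+1≡mp : a ℕ.* a ℕ.+ b ℕ.* b ℕ.+ 1 ≡ m ℕ.* p
    a²+b²+1≡mp = begin
      a ℕ.* a ℕ.+ b ℕ.* b ℕ.+ 1
                                 ≡⟨ cong₂ (λ x y → x ℕ.+ y ℕ.+ 1) (m≡m%n+[m/n]*n (a ℕ.* a) p) (m≡m%n+[m/n]*n (b ℕ.* b) p) ⟩
      ((a ℕ.* a) % p ℕ.+ qa ℕ.* p) ℕ.+ ((b ℕ.* b) % p ℕ.+ qb ℕ.* p) ℕ.+ 1
                                 ≡⟨ regroup ((a ℕ.* a) % p) ((b ℕ.* b) % p) qa qb p ⟩
      ((a ℕ.* a) % p ℕ.+ suc ((b ℕ.* b) % p)) ℕ.+ (qa ℕ.+ qb) ℕ.* p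
                                 ≡⟨ cong (λ x → x ℕ.+ suc ((b ℕ.* b) % p) ℕ.+ (qa ℕ.+ qb) ℕ.* p) a²+b²+1≡0 ⟩
      (p ℕ.∸ suc ((b ℕ.* b) % p) ℕ.+ suc ((b ℕ.* b) % p)) ℕ.+ (qa ℕ.+ qb) ℕ.* p
                                 ≡⟨ cong (ℕ._+ (qa ℕ.+ qb) ℕ.* p) (ℕ.m∸n+n≡m (m%n<n (b ℕ.* b) p)) ⟩
      p ℕ.+ (qa ℕ.+ qb) ℕ.* p    ∎
      where
      open ≡-Reasoning
      regroup : ∀ ra rb qa qb p →
                (ra ℕ.+ qa ℕ.* p) ℕ.+ (rb ℕ.+ qb ℕ.* p) ℕ.+ 1 ≡ (ra ℕ.+ suc rb) ℕ.+ (qa ℕ.+ qb) ℕ.* p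
      regroup = ℕ-Solver.solve-∀
    m<p : m < p
    m<p = ℕ.*-cancelʳ-< p m p (begin-strict
      m ℕ.* p                        ≡⟨ a²+b²+1≡mp ⟨
      a ℕ.* a ℕ.+ b ℕ.* b ℕ.+ 1      ≤⟨ ℕ.+-monoˡ-≤ 1 (ℕ.+-mono-≤ (ℕ.*-mono-≤ a≤h a≤h) (ℕ.*-mono-≤ b≤h b≤h)) ⟩
      h ℕ.* h ℕ.+ h ℕ.* h ℕ.+ 1      <⟨ h²+h²+1<p² ⟩
      p ℕ.* p                        ∎)
      where open ℕ.≤-Reasoning

  square-mod : ℕ → Fin p
  square-mod a = fromℕ< (m%n<n (a ℕ.* a) p)

  -- a ≤ h is coloured by a² mod p and h + 1 + b by p - 1 - (b² mod p); two of the p + 1 colours agree.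
  colour : (a : ℕ) → Dec (a ≤ h) → Fin p
  colour a (yes _) = square-mod a
  colour a (no _) = opposite (square-mod (a ℕ.∸ suc h))

  toℕ-square-mod : ∀ a → toℕ (square-mod a) ≡ (a ℕ.* a) % p
  toℕ-square-mod a = Fin.toℕ-fromℕ< (m%n<n (a ℕ.* a) p)

  same-square-mod : ∀ a b → square-mod a ≡ square-mod b → (a ℕ.* a) % p ≡ (b ℕ.* b) % p
  same-square-mod a b eq = trans (sym (toℕ-square-mod a)) (trans (cong toℕ eq) (toℕ-square-mod b))

  ∸h≤h : ∀ {b} → b ≤ p → b ℕ.∸ suc h ≤ h
  ∸h≤h {b} b≤p = ℕ.≤-trans (ℕ.∸-monoˡ-≤ (suc h) b≤p) (ℕ.≤-reflexive p∸[1+h]≡h)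
    where
    p∸[1+h]≡h : p ℕ.∸ suc h ≡ h
    p∸[1+h]≡h rewrite p≡2h+1 = trans (ℕ.m+n∸m≡n h (h ℕ.+ 0)) (ℕ.+-identityʳ h)

  same-colour : ∀ a b (a≤?h : Dec (a ≤ h)) (b≤?h : Dec (b ≤ h)) → a < b → b ≤ p →
                colour a a≤?h ≡ colour b b≤?h → ∃ λ m → 0 < m × m < p × FourSquares (+ m * + p)
  same-colour a b (yes _) (yes b≤h) a<b _ eq = contradiction (same-square-mod a b eq) (squares-distinct-mod a<b b≤h)
  same-colour a b (yes a≤h) (no _) _ b≤p eq = multiple-from-residues a≤h (∸h≤h b≤p) (begin
    (a ℕ.* a) % p                      ≡⟨ toℕ-square-mod a ⟨
    toℕ (square-mod a)                 ≡⟨ cong toℕ eq ⟩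
    toℕ (opposite (square-mod b′))     ≡⟨ Fin.opposite-prop (square-mod b′) ⟩
    p ℕ.∸ suc (toℕ (square-mod b′))    ≡⟨ cong (λ r → p ℕ.∸ suc r) (toℕ-square-mod b′) ⟩
    p ℕ.∸ suc ((b′ ℕ.* b′) % p)        ∎)
    where
    open ≡-Reasoning
    b′ = b ℕ.∸ suc h
  same-colour a b (no a≰h) (yes b≤h) a<b _ _ = contradiction (ℕ.≤-trans (ℕ.<⇒≤ a<b) b≤h) a≰h
  same-colour a b (no a≰h) (no _) a<b b≤p eq =
    contradiction (same-square-mod a′ b′ (opposite-injective eq)) (squares-distinct-mod a′<b′ (∸h≤h b≤p))
    where
    a′ = a ℕ.∸ suc h
    b′ = b ℕ.∸ suc h
    a′<b′ : a′ < b′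
    a′<b′ = ℕ.∸-monoˡ-< a<b (ℕ.≰⇒> a≰h)
    opposite-injective : ∀ {x y : Fin p} → opposite x ≡ opposite y → x ≡ y
    opposite-injective {x} {y} eq =
      trans (sym (Fin.opposite-involutive x)) (trans (cong opposite eq) (Fin.opposite-involutive y))

  small-multiple : ∃ λ m → 0 < m × m < p × FourSquares (+ m * + p)
  small-multiple with Fin.pigeonhole (ℕ.n<1+n p) (λ i → colour (toℕ i) (toℕ i ℕ.≤? h))
  ... | i , j , i<j , eq = same-colour (toℕ i) (toℕ j) (toℕ i ℕ.≤? h) (toℕ j ℕ.≤? h) i<j (Fin.toℕ≤pred[n] j) eq

odd-prime-fourSquares : ∀ {p h} → Prime p → p ≡ suc (2 ℕ.* h) → FourSquares (+ p)
odd-prime-fourSquares {h = h} p-prime p≡2h+1 with small-multiple {h = h} p-prime p≡2h+1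
... | m , 0<m , m<p , mp-squares = descent p-prime m 0<m m<p mp-squares

prime-fourSquares : ∀ {p} → Prime p → FourSquares (+ p)
prime-fourSquares {p} p-prime = by-parity (p % 2) (m%n<n p 2) (m≡m%n+[m/n]*n p 2)
  where
  instance
    p≢0 : ℕ.NonZero p
    p≢0 = prime⇒nonZero p-prime
  by-parity : ∀ r → r < 2 → p ≡ r ℕ.+ (p / 2) ℕ.* 2 → FourSquares (+ p)
  by-parity 0 _ p≡h*2 with prime⇒irreducible p-prime (ℕ.divides (p / 2) p≡h*2)
  ... | inj₁ ()
  ... | inj₂ 2≡p = subst (FourSquares ∘ +_) 2≡p (⟨ 1ℤ , 1ℤ , 0ℤ , 0ℤ ⟩ , refl)
  by-parity 1 _ p≡1+h*2 = odd-prime-fourSquares {h = p / 2} p-prime (trans p≡1+h*2 (cong suc (ℕ.*-comm (p / 2) 2)))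
  by-parity (suc (suc _)) (ℕ.s≤s (ℕ.s≤s ())) _

lagrange : ∀ n → FourSquares (+ n)
lagrange = <-rec (FourSquares ∘ +_) step
  where
  step : ∀ n → (∀ {m} → m < n → FourSquares (+ m)) → FourSquares (+ n)
  step 0 _ = ⟨ 0ℤ , 0ℤ , 0ℤ , 0ℤ ⟩ , refl
  step 1 _ = ⟨ 1ℤ , 0ℤ , 0ℤ , 0ℤ ⟩ , refl
  step n@(suc (suc _)) rec with prime? n
  ... | yes n-prime = prime-fourSquares n-prime
  ... | no ¬n-prime with ¬prime⇒composite ¬n-prime
  ...   | composite {d} d<n (ℕ.divides q@(suc _) n≡qd) =
    subst (FourSquares ∘ +_) (sym n≡qd) (subst FourSquares (sym (ℤ.pos-* q d)) (fourSquares-* (rec q<n) (rec d<n)))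
    where
    q<n : q < n
    q<n = subst (q <_) (sym n≡qd) (ℕ.m<m*n q d (ℕ.nonTrivial⇒n>1 d))

-- Sums of squares avoiding ±ρ

9∣⇒3∣ : ∀ {n} → + 9 ∣ℤ n → + 3 ∣ℤ n
9∣⇒3∣ = ∣-trans (divides (+ 3) refl)

∣m+n∣n⇒∣m-n : ∀ {d} m {n} → d ∣ℤ m + n → d ∣ℤ n → d ∣ℤ m - n
∣m+n∣n⇒∣m-n m d∣m+n d∣n = ∣m∣n⇒∣m-n (∣m+n∣n⇒∣m {m = m} d∣m+n d∣n) d∣n

Avoids : ℕ → ℤ → Set
Avoids ρ x = ∣ x ∣ ≢ ρ

record Avoiding₃ (ρ : ℕ) (n : ℤ) : Set where
  constructor avoiding₃
  field
    a b c : ℤ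
    a≉ρ : Avoids ρ a
    b≉ρ : Avoids ρ b
    c≉ρ : Avoids ρ c
    sum≡ : a * a + b * b + c * c ≡ n

avoiding₃-subst : ∀ {ρ m n} → m ≡ n → Avoiding₃ ρ m → Avoiding₃ ρ n
avoiding₃-subst refl a = a

∣∣≡⇒≡± : ∀ {w ρ} → ∣ w ∣ ≡ ρ → w ≡ + ρ ⊎ w ≡ - + ρ
∣∣≡⇒≡± {w} refl with ℤ.+∣i∣≡i⊎+∣i∣≡-i w
... | inj₁ +∣w∣≡w = inj₁ (sym +∣w∣≡w)
... | inj₂ +∣w∣≡-w = inj₂ (trans (sym (ℤ.neg-involutive w)) (cong -_ (sym +∣w∣≡-w)))

Hits : ℤ → ℤ → ℤ → ℤ → Set
Hits r a b c = (+ 3 * r ∣ℤ a + r) ⊎ (+ 3 * r ∣ℤ b + r) ⊎ (+ 3 * r ∣ℤ c + r)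

Hits-cong : ∀ {r a b c a′ b′ c′} → a ≡ a′ → b ≡ b′ → c ≡ c′ → Hits r a b c → Hits r a′ b′ c′
Hits-cong refl refl refl hits = hits

-- (w₀, w₁, w₂) is the reflection of (ρ, x, y) in the plane orthogonal to (1, 1, 1), so it has the same
-- sum of squares; an entry ±ρ forces one of x + y, x - 2 y, y - 2 x to be ≡ -ρ modulo 3ρ.
reflection-avoids-or-hits : ∀ ρ x y k → + 3 * k ≡ + ρ + x + y →
  Avoiding₃ ρ (+ ρ * + ρ + x * x + y * y) ⊎ Hits (+ ρ) (x + y) (x - + 2 * y) (y - + 2 * x)
reflection-avoids-or-hits ρ x y k 3k≡ρ+x+y = classify (∣ w₀ ∣ ℕ.≟ ρ) (∣ w₁ ∣ ℕ.≟ ρ) (∣ w₂ ∣ ℕ.≟ ρ)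
  where
  r = + ρ
  w₀ = r - + 2 * k
  w₁ = x - + 2 * k
  w₂ = y - + 2 * k

  drop-3k : ∀ {n} m c → n ≡ m + c * (+ 3 * k - (r + x + y)) → n ≡ m
  drop-3k m c n≡ = trans n≡ (trans (cong (λ t → m + c * (t - (r + x + y))) 3k≡ρ+x+y) (cancel m c (r + x + y)))
    where
    cancel : ∀ m c s → m + c * (s - s) ≡ m
    cancel = solve-∀

  norm : w₀ * w₀ + w₁ * w₁ + w₂ * w₂ ≡ r * r + x * x + y * y
  norm = drop-3k (r * r + x * x + y * y) (+ 4 * k) (expand r x y k)
    where
    expand : ∀ r x y k → (r - + 2 * k) * (r - + 2 * k) + (x - + 2 * k) * (x - + 2 * k) + (y - + 2 * k) * (y - + 2 * k)
                         ≡ r * r + x * x + y * y + + 4 * k * (+ 3 * k - (r + x + y))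
    expand = solve-∀

  3w₁ : x - + 2 * y + r ≡ + 3 * (w₁ + r)
  3w₁ = drop-3k (+ 3 * (w₁ + r)) (+ 2) (expand r x y k)
    where
    expand : ∀ r x y k → x - + 2 * y + r ≡ + 3 * ((x - + 2 * k) + r) + + 2 * (+ 3 * k - (r + x + y))
    expand = solve-∀

  3w₂ : y - + 2 * x + r ≡ + 3 * (w₂ + r)
  3w₂ = drop-3k (+ 3 * (w₂ + r)) (+ 2) (expand r x y k)
    where
    expand : ∀ r x y k → y - + 2 * x + r ≡ + 3 * ((y - + 2 * k) + r) + + 2 * (+ 3 * k - (r + x + y))
    expand = solve-∀

  -- 3 w₁ = (x - 2 y + r) - 3 r, so w₁ = ± r makes x - 2 y + r one of 0 and 6 r.
  side-hit : ∀ w {s} → s ≡ + 3 * (w + r) → ∣ w ∣ ≡ ρ → + 3 * r ∣ℤ s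
  side-hit w refl ∣w∣≡ρ with ∣∣≡⇒≡± {w} ∣w∣≡ρ
  ... | inj₁ refl = divides (+ 2) (lemma r)
    where
    lemma : ∀ r → + 3 * (r + r) ≡ + 2 * (+ 3 * r)
    lemma = solve-∀
  ... | inj₂ refl = divides 0ℤ (lemma r)
    where
    lemma : ∀ r → + 3 * (- r + r) ≡ 0ℤ * (+ 3 * r)
    lemma = solve-∀

  -- w₀ = r - 2 k = ± r forces k ∈ {0, r}, and x + y + r = 3 k.
  centre-hit : ∣ w₀ ∣ ≡ ρ → + 3 * r ∣ℤ x + y + r
  centre-hit ∣w₀∣≡ρ = subst (+ 3 * r ∣ℤ_) (trans 3k≡ρ+x+y (lemma r x y)) (*-monoʳ-∣ (+ 3) (r∣k (∣∣≡⇒≡± {w₀} ∣w₀∣≡ρ)))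
    where
    lemma : ∀ r x y → r + x + y ≡ x + y + r
    lemma = solve-∀
    2k≡r-w₀ : + 2 * k ≡ r - w₀
    2k≡r-w₀ = expand r k
      where
      expand : ∀ r k → + 2 * k ≡ r - (r - + 2 * k)
      expand = solve-∀
    r∣k : w₀ ≡ r ⊎ w₀ ≡ - r → r ∣ℤ k
    r∣k (inj₁ w₀≡r) =
      divides 0ℤ (ℤ.*-cancelˡ-≡ (+ 2) k _ (trans 2k≡r-w₀ (trans (cong (_-_ r) w₀≡r) (ℤ.+-inverseʳ r))))
    r∣k (inj₂ w₀≡-r) =
      divides 1ℤ (ℤ.*-cancelˡ-≡ (+ 2) k _ (trans 2k≡r-w₀ (trans (cong (_-_ r) w₀≡-r) (lemma′ r))))
      where
      lemma′ : ∀ r → r - - r ≡ + 2 * (1ℤ * r)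
      lemma′ = solve-∀

  classify : Dec (∣ w₀ ∣ ≡ ρ) → Dec (∣ w₁ ∣ ≡ ρ) → Dec (∣ w₂ ∣ ≡ ρ) →
             Avoiding₃ ρ (r * r + x * x + y * y) ⊎ Hits r (x + y) (x - + 2 * y) (y - + 2 * x)
  classify (no w₀≉ρ) (no w₁≉ρ) (no w₂≉ρ) = inj₁ (avoiding₃ w₀ w₁ w₂ w₀≉ρ w₁≉ρ w₂≉ρ norm)
  classify (yes w₀≈ρ) _ _ = inj₂ (inj₁ (centre-hit w₀≈ρ))
  classify _ (yes w₁≈ρ) _ = inj₂ (inj₂ (inj₁ (side-hit w₁ 3w₁ w₁≈ρ)))
  classify _ _ (yes w₂≈ρ) = inj₂ (inj₂ (inj₂ (side-hit w₂ 3w₂ w₂≈ρ)))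

module _ {ρ : ℕ} .{{_ : ℕ.NonZero ρ}} where
  private r = + ρ

  hit-opposite-⊥ : ∀ a → + 3 * r ∣ℤ a + r → + 3 * r ∣ℤ - a + r → ⊥
  hit-opposite-⊥ a 3r∣a+r 3r∣-a+r = ℕ.<-irrefl refl (ℕ.*-cancelʳ-≤ 3 2 ρ 3ρ≤2ρ)
    where
    3r∣2r : + 3 * r ∣ℤ + 2 * r
    3r∣2r = subst (+ 3 * r ∣ℤ_) (lemma a r) (∣m∣n⇒∣m+n {+ 3 * r} {a + r} 3r∣a+r 3r∣-a+r)
      where
      lemma : ∀ a r → a + r + (- a + r) ≡ + 2 * r
      lemma = solve-∀
    3ρ≤2ρ : 3 ℕ.* ρ ℕ.≤ 2 ℕ.* ρ
    3ρ≤2ρ = ℕ.∣⇒≤ {{ℕ.>-nonZero (ℕ.*-monoʳ-< 2 {0} {ρ} (ℕ.>-nonZero⁻¹ ρ))}}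
              (subst₂ ℕ._∣_ (ℤ.abs-* (+ 3) r) (ℤ.abs-* (+ 2) r) (∣⇒∣ᵤ 3r∣2r))

  hit⇒∣ : ∀ a → + 3 * r ∣ℤ a + r → r ∣ℤ a
  hit⇒∣ _ 3r∣a+r = ∣m+n∣n⇒∣m (∣-trans (divides (+ 3) refl) 3r∣a+r) ∣-refl

  hit⁻⇒∣ : ∀ a → + 3 * r ∣ℤ - a + r → r ∣ℤ a
  hit⁻⇒∣ a 3r∣-a+r = subst (r ∣ℤ_) (ℤ.neg-involutive a) (∣m⇒∣-m (hit⇒∣ (- a) 3r∣-a+r))

  ∣-first : ∀ a b c → a + b + c ≡ 0ℤ → r ∣ℤ b → r ∣ℤ c → r ∣ℤ a
  ∣-first a b c Σ≡0 r∣b r∣c = subst (r ∣ℤ_) (lemma a b c)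
    (∣m∣n⇒∣m-n (subst (r ∣ℤ_) (sym Σ≡0) (divides 0ℤ refl)) (∣m∣n⇒∣m+n r∣b r∣c))
    where
    lemma : ∀ a b c → a + b + c - (b + c) ≡ a
    lemma = solve-∀

  ∣-middle : ∀ a b c → a + b + c ≡ 0ℤ → r ∣ℤ a → r ∣ℤ c → r ∣ℤ b
  ∣-middle a b c Σ≡0 r∣a r∣c = subst (r ∣ℤ_) (lemma a b c)
    (∣m∣n⇒∣m-n (subst (r ∣ℤ_) (sym Σ≡0) (divides 0ℤ refl)) (∣m∣n⇒∣m+n r∣a r∣c))
    where
    lemma : ∀ a b c → a + b + c - (a + c) ≡ b
    lemma = solve-∀

  opposite-hits⇒∣ : ∀ a b c → a + b + c ≡ 0ℤ → Hits r a b c → Hits r (- a) (- b) (- c) → (r ∣ℤ a) × (r ∣ℤ b)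
  opposite-hits⇒∣ a b c _ (inj₁ ha) (inj₁ ha′) = ⊥-elim (hit-opposite-⊥ a ha ha′)
  opposite-hits⇒∣ a b c _ (inj₂ (inj₁ hb)) (inj₂ (inj₁ hb′)) = ⊥-elim (hit-opposite-⊥ b hb hb′)
  opposite-hits⇒∣ a b c _ (inj₂ (inj₂ hc)) (inj₂ (inj₂ hc′)) = ⊥-elim (hit-opposite-⊥ c hc hc′)
  opposite-hits⇒∣ a b c _ (inj₁ ha) (inj₂ (inj₁ hb′)) = hit⇒∣ a ha , hit⁻⇒∣ b hb′
  opposite-hits⇒∣ a b c _ (inj₂ (inj₁ hb)) (inj₁ ha′) = hit⁻⇒∣ a ha′ , hit⇒∣ b hb
  opposite-hits⇒∣ a b c Σ≡0 (inj₁ ha) (inj₂ (inj₂ hc′)) =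
    hit⇒∣ a ha , ∣-middle a b c Σ≡0 (hit⇒∣ a ha) (hit⁻⇒∣ c hc′)
  opposite-hits⇒∣ a b c Σ≡0 (inj₂ (inj₂ hc)) (inj₁ ha′) =
    hit⁻⇒∣ a ha′ , ∣-middle a b c Σ≡0 (hit⁻⇒∣ a ha′) (hit⇒∣ c hc)
  opposite-hits⇒∣ a b c Σ≡0 (inj₂ (inj₁ hb)) (inj₂ (inj₂ hc′)) =
    ∣-first a b c Σ≡0 (hit⇒∣ b hb) (hit⁻⇒∣ c hc′) , hit⇒∣ b hb
  opposite-hits⇒∣ a b c Σ≡0 (inj₂ (inj₂ hc)) (inj₂ (inj₁ hb′)) =
    ∣-first a b c Σ≡0 (hit⁻⇒∣ b hb′) (hit⇒∣ c hc) , hit⁻⇒∣ b hb′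

  aligned-hits-⊥ : ∀ a b c → + 3 * r ∣ℤ a - b → + 3 * r ∣ℤ a - c → Hits r a b c → Hits r (- a) (- b) (- c) → ⊥
  aligned-hits-⊥ a b c 3r∣a-b 3r∣a-c h h′ = hit-opposite-⊥ a (to-a h) (to-a′ h′)
    where
    shift : ∀ x y → + 3 * r ∣ℤ x + r → + 3 * r ∣ℤ y - x → + 3 * r ∣ℤ y + r
    shift x y 3r∣x+r 3r∣y-x = subst (+ 3 * r ∣ℤ_) (lemma x y r) (∣m∣n⇒∣m+n 3r∣x+r 3r∣y-x)
      where
      lemma : ∀ x y r → x + r + (y - x) ≡ y + r
      lemma = solve-∀
    negate : ∀ x y → + 3 * r ∣ℤ x - y → + 3 * r ∣ℤ - x - - y
    negate x y 3r∣x-y = subst (+ 3 * r ∣ℤ_) (lemma x y) (∣m⇒∣-m 3r∣x-y)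
      where
      lemma : ∀ x y → - (x - y) ≡ - x - - y
      lemma = solve-∀
    to-a : Hits r a b c → + 3 * r ∣ℤ a + r
    to-a (inj₁ ha) = ha
    to-a (inj₂ (inj₁ hb)) = shift b a hb 3r∣a-b
    to-a (inj₂ (inj₂ hc)) = shift c a hc 3r∣a-c
    to-a′ : Hits r (- a) (- b) (- c) → + 3 * r ∣ℤ - a + r
    to-a′ (inj₁ ha′) = ha′
    to-a′ (inj₂ (inj₁ hb′)) = shift (- b) (- a) hb′ (negate a b 3r∣a-b)
    to-a′ (inj₂ (inj₂ hc′)) = shift (- c) (- a) hc′ (negate a c 3r∣a-c)

  BothHit : ℤ → ℤ → Set
  BothHit x y = Hits r (x + y) (x - + 2 * y) (y - + 2 * x) × Hits r (- (x + y)) (- (x - + 2 * y)) (- (y - + 2 * x))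

  reflections : + 3 ∣ℤ r → ∀ x y → + 3 ∣ℤ x + y →
    Avoiding₃ ρ (r * r + x * x + y * y) ⊎ BothHit x y
  reflections (divides t r≡t*3) x y (divides s x+y≡s*3)
    with reflection-avoids-or-hits ρ x y (t + s) 3k₊ | reflection-avoids-or-hits ρ (- x) (- y) (t - s) 3k₋
    where
    3k₊ : + 3 * (t + s) ≡ r + x + y
    3k₊ = begin
      + 3 * (t + s)        ≡⟨ lemma t s ⟩
      t * + 3 + s * + 3    ≡⟨ cong₂ _+_ r≡t*3 x+y≡s*3 ⟨
      r + (x + y)          ≡⟨ ℤ.+-assoc r x y ⟨
      r + x + y            ∎
      where
      open ≡-Reasoning
      lemma : ∀ t s → + 3 * (t + s) ≡ t * + 3 + s * + 3
      lemma = solve-∀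
    3k₋ : + 3 * (t - s) ≡ r + - x + - y
    3k₋ = begin
      + 3 * (t - s)        ≡⟨ lemma t s ⟩
      t * + 3 - s * + 3    ≡⟨ cong₂ _-_ r≡t*3 x+y≡s*3 ⟨
      r - (x + y)          ≡⟨ lemma′ r x y ⟩
      r + - x + - y        ∎
      where
      open ≡-Reasoning
      lemma : ∀ t s → + 3 * (t - s) ≡ t * + 3 - s * + 3
      lemma = solve-∀
      lemma′ : ∀ r x y → r - (x + y) ≡ r + - x + - y
      lemma′ = solve-∀
  ... | inj₁ avoiding | _ = inj₁ avoiding
  ... | inj₂ _ | inj₁ avoiding = inj₁ (avoiding₃-subst (lemma r x y) avoiding)
    where
    lemma : ∀ r x y → r * r + - x * - x + - y * - y ≡ r * r + x * x + y * y
    lemma = solve-∀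
  ... | inj₂ hits | inj₂ hits′ = inj₂ (hits , Hits-cong (lemma₁ x y) (lemma₂ x y) (lemma₃ x y) hits′)
    where
    lemma₁ : ∀ x y → - x + - y ≡ - (x + y)
    lemma₁ = solve-∀
    lemma₂ : ∀ x y → - x - + 2 * - y ≡ - (x - + 2 * y)
    lemma₂ = solve-∀
    lemma₃ : ∀ x y → - y - + 2 * - x ≡ - (y - + 2 * x)
    lemma₃ = solve-∀

  bothHit⇒r∣ : ∀ x y → BothHit x y → (r ∣ℤ x + y) × (r ∣ℤ x - + 2 * y)
  bothHit⇒r∣ x y (hits , hits′) = opposite-hits⇒∣ (x + y) (x - + 2 * y) (y - + 2 * x) (lemma x y) hits hits′
    where
    lemma : ∀ x y → x + y + (x - + 2 * y) + (y - + 2 * x) ≡ 0ℤ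
    lemma = solve-∀

  bothHit⇒3∣y : + 9 ∣ℤ r → ∀ x y → BothHit x y → + 3 ∣ℤ y
  bothHit⇒3∣y 9∣r x y hit with bothHit⇒r∣ x y hit
  ... | r∣x+y , r∣x-2y = *-cancelˡ-∣ (+ 3) (∣-trans 9∣r (subst (r ∣ℤ_) (lemma x y) (∣m∣n⇒∣m-n r∣x+y r∣x-2y)))
    where
    lemma : ∀ x y → x + y - (x - + 2 * y) ≡ + 3 * y
    lemma = solve-∀

  -- Both pairs of hits make ρ divide x and y, so the three forms agree modulo 3ρ.
  bothHit±-⊥ : ∀ x y → BothHit x y → BothHit x (- y) → ⊥
  bothHit±-⊥ x y hit@(hits , hits′) hit′ with bothHit⇒r∣ x y hit | bothHit⇒r∣ x (- y) hit′
  ... | r∣x+y , r∣x-2y | r∣x-y , _ =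
    aligned-hits-⊥ (x + y) (x - + 2 * y) (y - + 2 * x) (3r∣ (lemma₁ x y) r∣y) (3r∣ (lemma₂ x y) r∣x) hits hits′
    where
    r∣y : r ∣ℤ y
    r∣y = subst (r ∣ℤ_) (lemma x y) (∣m∣n⇒∣m-n r∣x-y r∣x-2y)
      where
      lemma : ∀ x y → x + - y - (x - + 2 * y) ≡ y
      lemma = solve-∀
    r∣x : r ∣ℤ x
    r∣x = subst (r ∣ℤ_) (lemma x y) (∣m∣n⇒∣m-n r∣x+y r∣y)
      where
      lemma : ∀ x y → x + y - y ≡ x
      lemma = solve-∀
    3r∣ : ∀ {s z} → s ≡ + 3 * z → r ∣ℤ z → + 3 * r ∣ℤ s
    3r∣ refl r∣z = *-monoʳ-∣ (+ 3) r∣z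
    lemma₁ : ∀ x y → x + y - (x - + 2 * y) ≡ + 3 * y
    lemma₁ = solve-∀
    lemma₂ : ∀ x y → x + y - (y - + 2 * x) ≡ + 3 * x
    lemma₂ = solve-∀

  avoid-pair : + 9 ∣ℤ r → ∀ x y → + 3 ∣ℤ x + y → Avoiding₃ ρ (r * r + x * x + y * y)
  avoid-pair 9∣r x y 3∣x+y with reflections (9∣⇒3∣ 9∣r) x y 3∣x+y
  ... | inj₁ avoiding = avoiding
  ... | inj₂ hit = with-y-negated (reflections (9∣⇒3∣ 9∣r) x (- y) (∣m+n∣n⇒∣m-n x 3∣x+y (bothHit⇒3∣y 9∣r x y hit)))
    where
    with-y-negated : Avoiding₃ ρ (r * r + x * x + - y * - y) ⊎ BothHit x (- y) → Avoiding₃ ρ (r * r + x * x + y * y)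
    with-y-negated (inj₁ avoiding) = avoiding₃-subst (lemma r x y) avoiding
      where
      lemma : ∀ r x y → r * r + x * x + - y * - y ≡ r * r + x * x + y * y
      lemma = solve-∀
    with-y-negated (inj₂ hit′) = ⊥-elim (bothHit±-⊥ x y hit hit′)

Paired : ℤ → ℤ → Set
Paired x y = (+ 3 ∣ℤ x + y) ⊎ (+ 3 ∣ℤ x - y)

Unit₃ : ℤ → Set
Unit₃ x = (+ 3 ∣ℤ x - 1ℤ) ⊎ (+ 3 ∣ℤ x + 1ℤ)

residue₃ : ∀ x → (+ 3 ∣ℤ x) ⊎ Unit₃ x
residue₃ x = by-remainder (x %ℕ 3) (n%ℕd<d x 3) (a≡a%ℕn+[a/ℕn]*n x 3)
  where
  q = x /ℕ 3
  by-remainder : ∀ r → r < 3 → x ≡ + r + q * + 3 → (+ 3 ∣ℤ x) ⊎ Unit₃ x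
  by-remainder 0 _ x≡ = inj₁ (divides q (trans x≡ (ℤ.+-identityˡ (q * + 3))))
  by-remainder 1 _ x≡ = inj₂ (inj₁ (divides q (trans (cong (_- 1ℤ) x≡) (lemma q))))
    where
    lemma : ∀ q → 1ℤ + q * + 3 - 1ℤ ≡ q * + 3
    lemma = solve-∀
  by-remainder 2 _ x≡ = inj₂ (inj₂ (divides (q + 1ℤ) (trans (cong (_+ 1ℤ) x≡) (lemma q))))
    where
    lemma : ∀ q → + 2 + q * + 3 + 1ℤ ≡ (q + 1ℤ) * + 3
    lemma = solve-∀
  by-remainder (suc (suc (suc _))) (ℕ.s≤s (ℕ.s≤s (ℕ.s≤s ()))) _

paired-units : ∀ x y → Unit₃ x → Unit₃ y → Paired x y
paired-units x y (inj₁ 3∣x-1) (inj₁ 3∣y-1) = inj₂ (subst (+ 3 ∣ℤ_) (lemma x y) (∣m∣n⇒∣m-n 3∣x-1 3∣y-1))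
  where
  lemma : ∀ x y → x - 1ℤ - (y - 1ℤ) ≡ x - y
  lemma = solve-∀
paired-units x y (inj₁ 3∣x-1) (inj₂ 3∣y+1) = inj₁ (subst (+ 3 ∣ℤ_) (lemma x y) (∣m∣n⇒∣m+n 3∣x-1 3∣y+1))
  where
  lemma : ∀ x y → x - 1ℤ + (y + 1ℤ) ≡ x + y
  lemma = solve-∀
paired-units x y (inj₂ 3∣x+1) (inj₁ 3∣y-1) = inj₁ (subst (+ 3 ∣ℤ_) (lemma x y) (∣m∣n⇒∣m+n 3∣x+1 3∣y-1))
  where
  lemma : ∀ x y → x + 1ℤ + (y - 1ℤ) ≡ x + y
  lemma = solve-∀
paired-units x y (inj₂ 3∣x+1) (inj₂ 3∣y+1) = inj₂ (subst (+ 3 ∣ℤ_) (lemma x y) (∣m∣n⇒∣m-n 3∣x+1 3∣y+1))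
  where
  lemma : ∀ x y → x + 1ℤ - (y + 1ℤ) ≡ x - y
  lemma = solve-∀

-- Pigeonhole on the classes 0 and ±1 modulo 3.
some-paired : ∀ x y z → Paired x y ⊎ Paired x z ⊎ Paired y z
some-paired x y z with residue₃ x | residue₃ y | residue₃ z
... | inj₁ 3∣x | inj₁ 3∣y | _      = inj₁ (inj₁ (∣m∣n⇒∣m+n 3∣x 3∣y))
... | inj₂ ux  | inj₂ uy  | _      = inj₁ (paired-units x y ux uy)
... | inj₁ 3∣x | inj₂ _   | inj₁ 3∣z = inj₂ (inj₁ (inj₁ (∣m∣n⇒∣m+n 3∣x 3∣z)))
... | inj₂ ux  | inj₁ _   | inj₂ uz  = inj₂ (inj₁ (paired-units x z ux uz))
... | inj₁ _   | inj₂ uy  | inj₂ uz  = inj₂ (inj₂ (paired-units y z uy uz))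
... | inj₂ _   | inj₁ 3∣y | inj₁ 3∣z = inj₂ (inj₂ (inj₁ (∣m∣n⇒∣m+n 3∣y 3∣z)))

record Avoiding₄ (ρ : ℕ) (n : ℤ) : Set where
  constructor avoiding₄
  field
    a b c d : ℤ
    a≉ρ : Avoids ρ a
    b≉ρ : Avoids ρ b
    c≉ρ : Avoids ρ c
    d≉ρ : Avoids ρ d
    sum≡ : a * a + b * b + c * c + d * d ≡ n

avoiding₄-subst : ∀ {ρ m n} → m ≡ n → Avoiding₄ ρ m → Avoiding₄ ρ n
avoiding₄-subst refl a = a

∣∣≡⇒sq : ∀ {w ρ} → ∣ w ∣ ≡ ρ → w * w ≡ + ρ * + ρ
∣∣≡⇒sq {w} {ρ} ∣w∣≡ρ with ∣∣≡⇒≡± {w} ∣w∣≡ρ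
... | inj₁ refl = refl
... | inj₂ refl = lemma (+ ρ)
  where
  lemma : ∀ r → - r * - r ≡ r * r
  lemma = solve-∀

module _ {ρ : ℕ} .{{_ : ℕ.NonZero ρ}} (9∣ρ : + 9 ∣ℤ + ρ) where

  avoid-paired : ∀ w → ∣ w ∣ ≡ ρ → ∀ x y → Paired x y → Avoiding₃ ρ (w * w + x * x + y * y)
  avoid-paired w ∣w∣≡ρ x y (inj₁ 3∣x+y) =
    avoiding₃-subst (cong (λ s → s + x * x + y * y) (sym (∣∣≡⇒sq {w} ∣w∣≡ρ))) (avoid-pair 9∣ρ x y 3∣x+y)
  avoid-paired w ∣w∣≡ρ x y (inj₂ 3∣x-y) =
    avoiding₃-subst (cong₂ (λ s t → s + x * x + t) (sym (∣∣≡⇒sq {w} ∣w∣≡ρ)) (lemma y)) (avoid-pair 9∣ρ x (- y) 3∣x-y)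
    where
    lemma : ∀ y → - y * - y ≡ y * y
    lemma = solve-∀

  absorb : ∀ {P : ℤ → Set} w → ∣ w ∣ ≡ ρ → ∀ x y z → P x → P y → P z →
           ∃₂ λ m r → Avoiding₃ ρ m × P r × m + r * r ≡ w * w + x * x + y * y + z * z
  absorb w ∣w∣≡ρ x y z px py pz with some-paired x y z
  ... | inj₁ xy = _ , z , avoid-paired w ∣w∣≡ρ x y xy , pz , refl
  ... | inj₂ (inj₁ xz) = _ , y , avoid-paired w ∣w∣≡ρ x z xz , py , lemma w x y z
    where
    lemma : ∀ w x y z → w * w + x * x + z * z + y * y ≡ w * w + x * x + y * y + z * z
    lemma = solve-∀
  ... | inj₂ (inj₂ yz) = _ , x , avoid-paired w ∣w∣≡ρ y z yz , px , lemma w x y z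
    where
    lemma : ∀ w x y z → w * w + y * y + z * z + x * x ≡ w * w + x * x + y * y + z * z
    lemma = solve-∀

  avoiding₄-extend : ∀ {m} → Avoiding₃ ρ m → ∀ z → Avoiding₄ ρ (m + z * z)
  avoiding₄-extend (avoiding₃ e f g e≉ρ f≉ρ g≉ρ refl) z with ∣ z ∣ ℕ.≟ ρ
  ... | no z≉ρ = avoiding₄ e f g z e≉ρ f≉ρ g≉ρ z≉ρ refl
  ... | yes ∣z∣≡ρ with absorb {Avoids ρ} z ∣z∣≡ρ e f g e≉ρ f≉ρ g≉ρ
  ...   | _ , r , avoiding₃ h i j h≉ρ i≉ρ j≉ρ refl , r≉ρ , eq =
    avoiding₄ h i j r h≉ρ i≉ρ j≉ρ r≉ρ (trans eq (lemma z e f g))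
    where
    lemma : ∀ z e f g → z * z + e * e + f * f + g * g ≡ e * e + f * f + g * g + z * z
    lemma = solve-∀

  avoiding₄-from-bad : ∀ w → ∣ w ∣ ≡ ρ → ∀ x y z → Avoiding₄ ρ (w * w + x * x + y * y + z * z)
  avoiding₄-from-bad w ∣w∣≡ρ x y z with absorb {const ⊤} w ∣w∣≡ρ x y z tt tt tt
  ... | _ , r , avoiding , _ , eq = avoiding₄-subst eq (avoiding₄-extend avoiding r)

  avoiding₄-of-squares : ∀ a b c d → Avoiding₄ ρ (a * a + b * b + c * c + d * d)
  avoiding₄-of-squares a b c d with ∣ a ∣ ℕ.≟ ρ | ∣ b ∣ ℕ.≟ ρ | ∣ c ∣ ℕ.≟ ρ | ∣ d ∣ ℕ.≟ ρ
  ... | no a≉ρ | no b≉ρ | no c≉ρ | no d≉ρ = avoiding₄ a b c d a≉ρ b≉ρ c≉ρ d≉ρ refl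
  ... | yes ∣a∣≡ρ | _ | _ | _ = avoiding₄-from-bad a ∣a∣≡ρ b c d
  ... | _ | yes ∣b∣≡ρ | _ | _ = avoiding₄-subst (lemma a b c d) (avoiding₄-from-bad b ∣b∣≡ρ a c d)
    where
    lemma : ∀ a b c d → b * b + a * a + c * c + d * d ≡ a * a + b * b + c * c + d * d
    lemma = solve-∀
  ... | _ | _ | yes ∣c∣≡ρ | _ = avoiding₄-subst (lemma a b c d) (avoiding₄-from-bad c ∣c∣≡ρ a b d)
    where
    lemma : ∀ a b c d → c * c + a * a + b * b + d * d ≡ a * a + b * b + c * c + d * d
    lemma = solve-∀
  ... | _ | _ | _ | yes ∣d∣≡ρ = avoiding₄-subst (lemma a b c d) (avoiding₄-from-bad d ∣d∣≡ρ a b c)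
    where
    lemma : ∀ a b c d → d * d + a * a + b * b + c * c ≡ a * a + b * b + c * c + d * d
    lemma = solve-∀

-- The values of k_ρ

+sumSq-∣∣ : ∀ a b c d → + sumSq (∣ a ∣ ∷ ∣ b ∣ ∷ ∣ c ∣ ∷ ∣ d ∣ ∷ []) ≡ a * a + b * b + c * c + d * d
+sumSq-∣∣ a b c d = begin
  + (A ℕ.+ (B ℕ.+ (C ℕ.+ (D ℕ.+ 0))))  ≡⟨ cong +_ (reassoc A B C D) ⟩
  + (A ℕ.+ B ℕ.+ C ℕ.+ D)              ≡⟨ +-sum₄ A B C D ⟩
  + A + + B + + C + + D          ≡⟨ +-cong₄ (+∣x∣² a) (+∣x∣² b) (+∣x∣² c) (+∣x∣² d) ⟩
  a * a + b * b + c * c + d * d ∎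
  where
  open ≡-Reasoning
  A = ∣ a ∣ ℕ.* ∣ a ∣
  B = ∣ b ∣ ℕ.* ∣ b ∣
  C = ∣ c ∣ ℕ.* ∣ c ∣
  D = ∣ d ∣ ℕ.* ∣ d ∣
  reassoc : ∀ a b c d → a ℕ.+ (b ℕ.+ (c ℕ.+ (d ℕ.+ 0))) ≡ a ℕ.+ b ℕ.+ c ℕ.+ d
  reassoc = ℕ-Solver.solve-∀
  +∣x∣² : ∀ x → + (∣ x ∣ ℕ.* ∣ x ∣) ≡ x * x
  +∣x∣² (+ n) = ℤ.pos-* n n
  +∣x∣² -[1+ n ] = refl

rep₄ : ∀ {ρ} .{{_ : ℕ.NonZero ρ}} → + 9 ∣ℤ + ρ → ∀ n → Rep ρ 4 n
rep₄ 9∣ρ n with lagrange n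
... | ⟨ a , b , c , d ⟩ , ‖u‖²≡n with avoiding₄-of-squares 9∣ρ a b c d
... | avoiding₄ a′ b′ c′ d′ a′≉ρ b′≉ρ c′≉ρ d′≉ρ sum≡ =
  (∣ a′ ∣ ∷ ∣ b′ ∣ ∷ ∣ c′ ∣ ∷ ∣ d′ ∣ ∷ []) , (a′≉ρ ∷ b′≉ρ ∷ c′≉ρ ∷ d′≉ρ ∷ []) ,
  ℤ.+-injective (trans (+sumSq-∣∣ a′ b′ c′ d′) (trans sum≡ ‖u‖²≡n))

KIs⇒≤ : ∀ {ρ n k m} → KIs ρ n k → 1 ≤ m → Rep ρ m n → k ≤ m
KIs⇒≤ (_ , _ , minimal) 1≤m rep = ℕ.≮⇒≥ (λ m<k → minimal _ 1≤m m<k rep)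

sq≤7⇒<3 : ∀ x → x ℕ.* x ≤ 7 → x < 3
sq≤7⇒<3 0 _ = ℕ.s≤s ℕ.z≤n
sq≤7⇒<3 1 _ = ℕ.s≤s (ℕ.s≤s ℕ.z≤n)
sq≤7⇒<3 2 _ = ℕ.s≤s (ℕ.s≤s (ℕ.s≤s ℕ.z≤n))
sq≤7⇒<3 (suc (suc (suc x))) x²≤7 = contradiction (ℕ.≤-trans (ℕ.*-mono-≤ 3≤x 3≤x) x²≤7) (from-no (9 ℕ.≤? 7))
  where
  3≤x : 3 ≤ suc (suc (suc x))
  3≤x = ℕ.s≤s (ℕ.s≤s (ℕ.s≤s ℕ.z≤n))

small-squares≢7 : ∀ (i j k : Fin 3) → sumSq (toℕ i ∷ toℕ j ∷ toℕ k ∷ []) ≢ 7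
small-squares≢7 = from-yes (Fin.all? {n = 3} λ i → Fin.all? {n = 3} λ j → Fin.all? {n = 3} λ k →
  ¬? (sumSq (toℕ i ∷ toℕ j ∷ toℕ k ∷ []) ℕ.≟ 7))

three-squares≢7 : ∀ x y z → sumSq (x ∷ y ∷ z ∷ []) ≢ 7
three-squares≢7 x y z sum≡7 with as-Fin x<3 | as-Fin y<3 | as-Fin z<3
  where
  as-Fin : ∀ {n} → n < 3 → ∃ λ (i : Fin 3) → toℕ i ≡ n
  as-Fin n<3 = fromℕ< n<3 , Fin.toℕ-fromℕ< n<3
  x<3 = sq≤7⇒<3 x (subst (x ℕ.* x ≤_) sum≡7 (ℕ.m≤m+n _ _))
  y<3 = sq≤7⇒<3 y (subst (y ℕ.* y ≤_) sum≡7 (ℕ.≤-trans (ℕ.m≤m+n _ _) (ℕ.m≤n+m _ (x ℕ.* x))))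
  z<3 = sq≤7⇒<3 z (subst (z ℕ.* z ≤_) sum≡7
          (ℕ.≤-trans (ℕ.m≤m+n _ 0) (ℕ.≤-trans (ℕ.m≤n+m _ (y ℕ.* y)) (ℕ.m≤n+m _ (x ℕ.* x)))))
... | i , refl | j , refl | k , refl = small-squares≢7 i j k sum≡7

¬Rep-7 : ∀ {ρ} m → 1 ≤ m → m < 4 → ¬ Rep ρ m 7
¬Rep-7 1 _ _ (x ∷ [] , _ , sum≡7) = three-squares≢7 x 0 0 sum≡7
¬Rep-7 2 _ _ (x ∷ y ∷ [] , _ , sum≡7) = three-squares≢7 x y 0 sum≡7
¬Rep-7 3 _ _ (x ∷ y ∷ z ∷ [] , _ , sum≡7) = three-squares≢7 x y z sum≡7
¬Rep-7 (suc (suc (suc (suc _)))) _ (ℕ.s≤s (ℕ.s≤s (ℕ.s≤s (ℕ.s≤s ())))) _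

seven-needs-four : ∀ {ρ} → 2 < ρ → KIs ρ 7 4
seven-needs-four {ρ} 2<ρ = ℕ.s≤s ℕ.z≤n , (2 ∷ 1 ∷ 1 ∷ 1 ∷ [] , 2≢ρ ∷ 1≢ρ ∷ 1≢ρ ∷ 1≢ρ ∷ [] , refl) , ¬Rep-7
  where
  2≢ρ : 2 ≢ ρ
  2≢ρ = ℕ.<⇒≢ 2<ρ
  1≢ρ : 1 ≢ ρ
  1≢ρ = ℕ.<⇒≢ (ℕ.<-trans (ℕ.s≤s (ℕ.s≤s ℕ.z≤n)) 2<ρ)

theorem3p6 : (ρ : ℕ) → 1 ≤ ρ → 9 ∣ ρ → MIs ρ 4
theorem3p6 ρ 1≤ρ 9∣ρ@(ℕ.divides t ρ≡t*9) = (7 , 1≤7 , 7∉I , k₇≡4) , kₙ≤4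
  where
  instance
    ρ≢0 : ℕ.NonZero ρ
    ρ≢0 = ℕ.>-nonZero 1≤ρ
  1≤7 : 1 ≤ 7
  1≤7 = ℕ.s≤s ℕ.z≤n
  k₇≡4 : KIs ρ 7 4
  k₇≡4 = seven-needs-four (ℕ.<-≤-trans (from-yes (2 ℕ.<? 9)) (ℕ.∣⇒≤ 9∣ρ))
  7∉I : ¬ InI ρ 7
  7∉I 7∈I = 7∈I 4 (ℕ.s≤s ℕ.z≤n) (proj₁ (proj₂ k₇≡4))
  kₙ≤4 : ∀ n k → 1 ≤ n → ¬ InI ρ n → KIs ρ n k → k ≤ 4
  kₙ≤4 n k _ _ kₙ≡k = KIs⇒≤ kₙ≡k (ℕ.s≤s ℕ.z≤n) (rep₄ (divides (+ t) (trans (cong +_ ρ≡t*9) (ℤ.pos-* t 9))) n)
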